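{- Let $\alpha=\frac{1+\sqrt5}{2}$. If an Elena of size $n$ is chosen uniformly at random, the expected number of children of its root tends to $\frac{3+\sqrt5}{2}=\alpha^2$ as $n\to\infty$.
   Context: Planted plane trees are rooted trees in which the children of every node are linearly ordered. An Elena is a planted plane tree of the following form: there are nodes $v_1,\dots,v_k$ ($k\ge 1$), with $v_1$ the root, such that for each $i<k$ the node $v_{i+1}$ is the rightmost child of $v_i$, the node $v_k$ is a leaf, and for each $i<k$ every other child of $v_i$ (any number $\ge0$ of them, placed to the left of $v_{i+1}$) is the top node of a path (a chain of $\ge1$ nodes each having at most one child). Equivalently, Elenas correspond to words of the language $(\mathtt{a}\,\mathtt{p}^*)^*\mathtt{a}$, with $\mathtt{a}$ a rightmost-branch node and $\mathtt{p}$ an attached path. Under the standard bijection with Dyck paths, Elenas of size $n$ correspond to nondecreasing Dyck paths (valley altitudes nondecreasing) of length $2(n-1)$. The size of an Elena is its number of nodes. -}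

module Defs where

open import Data.Nat using (ℕ; suc) renaming (_+_ to _+ℕ_)
open import Data.List using (List; []; _∷_; [_]; _++_; length; map)
open import Data.Nat.ListAction using (sum)
open import Data.List.Relation.Unary.All using (All)
open import Data.Integer using (+_)
open import Data.Rational using (ℚ; _/_; _*_; _-_; _<_; 0ℚ)
open import Data.Product using (_×_)
open import Data.Sum using (_⊎_)

data PTree : Set where
  node : List PTree → PTree

size : PTree → ℕ
sizes : List PTree → ℕ
size (node cs) = suc (sizes cs)
sizes [] = 0
sizes (t ∷ ts) = size t +ℕ sizes ts

rootChildren : PTree → ℕ
rootChildren (node cs) = length cs

data IsPath : PTree → Set where
  leaf : IsPath (node [])
  step : ∀ {t} → IsPath t → IsPath (node (t ∷ []))

-- Elena: the rightmost child continues the spine, all other children are paths;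
-- the spine ends in a leaf.
data IsElena : PTree → Set where
  leaf   : IsElena (node [])
  branch : ∀ {ps t} → All IsPath ps → IsElena t → IsElena (node (ps ++ [ t ]))

ℕ→ℚ : ℕ → ℚ
ℕ→ℚ n = + n / 1

-- Dedekind-cut description of α² = (3+√5)/2, via x < α² ⇔ 2x-3 < √5
-- and α² < x ⇔ √5 < 2x-3 (all rationals involved).
BelowAlphaSq : ℚ → Set
BelowAlphaSq q = let d = ℕ→ℚ 2 * q - ℕ→ℚ 3 in d < 0ℚ ⊎ d * d < ℕ→ℚ 5

AboveAlphaSq : ℚ → Set
AboveAlphaSq r = let d = ℕ→ℚ 2 * r - ℕ→ℚ 3 in 0ℚ < d × ℕ→ℚ 5 < d * d

count : List PTree → ℚ
count ts = ℕ→ℚ (length ts)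

totalRootChildren : List PTree → ℚ
totalRootChildren ts = ℕ→ℚ (sum (map rootChildren ts))

module Submission where

-- Let e(n) be the number of Elenas of size n and t(n) the total number of
-- children of their roots.  The proof has a combinatorial and an arithmetic half.
--
-- Reading an Elena along its spine, a non-leaf
-- Elena is either a planted Elena (the root has one child) or has at least two
-- root children, and the latter arise uniquely from smaller Elenas by adding a
-- one-node path or by lengthening the leftmost path.  This yields an explicit
-- duplicate-free enumeration, whence e(m+2) = F(2m+1) and t(m+2) = F(2m+3) − 2^m
-- (F the Fibonacci numbers).
--
-- With
-- X = F(2m+1), Z = F(2m+3) and d = L(2m+1) one has d² + 4 = 5X² and 2Z = 3X + d,
-- so Z/X is a convergent of α² = (3 + √5)/2 from below.  For rational r > α² this
-- gives t < Z < r·X outright; for rational q < α² the Pell equation gives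
-- q·X < Z − 2^m as soon as X > 20·den(q)²·2^m, which holds for large m because
-- F(2m+1) grows like α^(2m) while 2^m does not.

module Fibonacci where

  open import Data.Nat using (ℕ; zero; suc; _+_; _*_; _^_; _≤_; _<_; z≤n; s≤s)
  open import Data.Nat.Properties
  open import Data.Nat.Solver using (module +-*-Solver)
  open import Relation.Binary.PropositionalEquality using (_≡_; refl; sym; cong; module ≡-Reasoning)
  open +-*-Solver

  -- oddFib m = F(2m−1) and evenFib m = F(2m), with F the Fibonacci numbers
  -- (F(−1) = 1); they count the Elenas by shape (see Elenas.length-enum).
  oddFib evenFib : ℕ → ℕ
  oddFib zero    = 1
  oddFib (suc m) = oddFib m + evenFib m
  evenFib zero    = 0
  evenFib (suc m) = oddFib m + evenFib m + evenFib m

  -- lucas m = L(2m+1), the odd-indexed Lucas numbers.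
  lucas : ℕ → ℕ
  lucas m = oddFib m + 3 * evenFib m

  cassini : ∀ m → evenFib m * evenFib m + 1 ≡ oddFib m * oddFib m + oddFib m * evenFib m
  cassini zero    = refl
  cassini (suc m) = begin
    (a + b + b) * (a + b + b) + 1
      ≡⟨ solve 2 (λ a b → (a :+ b :+ b) :* (a :+ b :+ b) :+ con 1
                        := (b :* b :+ con 1) :+ (a :* a :+ con 4 :* a :* b :+ con 3 :* b :* b)) refl a b ⟩
    (b * b + 1) + (a * a + 4 * a * b + 3 * b * b)
      ≡⟨ cong (_+ (a * a + 4 * a * b + 3 * b * b)) (cassini m) ⟩
    (a * a + a * b) + (a * a + 4 * a * b + 3 * b * b)
      ≡⟨ solve 2 (λ a b → (a :* a :+ a :* b) :+ (a :* a :+ con 4 :* a :* b :+ con 3 :* b :* b)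
                        := (a :+ b) :* (a :+ b) :+ (a :+ b) :* (a :+ b :+ b)) refl a b ⟩
    (a + b) * (a + b) + (a + b) * (a + b + b) ∎
    where
    open ≡-Reasoning
    a b : ℕ
    a = oddFib m
    b = evenFib m

  pell : ∀ m → lucas m * lucas m + 4 ≡ 5 * (oddFib (suc m) * oddFib (suc m))
  pell m = begin
    (a + 3 * b) * (a + 3 * b) + 4
      ≡⟨ solve 2 (λ a b → (a :+ con 3 :* b) :* (a :+ con 3 :* b) :+ con 4
                        := (a :* a :+ con 6 :* a :* b :+ con 5 :* b :* b) :+ con 4 :* (b :* b :+ con 1)) refl a b ⟩
    (a * a + 6 * a * b + 5 * b * b) + 4 * (b * b + 1)
      ≡⟨ cong (λ x → (a * a + 6 * a * b + 5 * b * b) + 4 * x) (cassini m) ⟩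
    (a * a + 6 * a * b + 5 * b * b) + 4 * (a * a + a * b)
      ≡⟨ solve 2 (λ a b → (a :* a :+ con 6 :* a :* b :+ con 5 :* b :* b) :+ con 4 :* (a :* a :+ a :* b)
                        := con 5 :* ((a :+ b) :* (a :+ b))) refl a b ⟩
    5 * ((a + b) * (a + b)) ∎
    where
    open ≡-Reasoning
    a b : ℕ
    a = oddFib m
    b = evenFib m

  doubling : ∀ m → 2 * oddFib (suc (suc m)) ≡ 3 * oddFib (suc m) + lucas m
  doubling m = solve 2 (λ a b → con 2 :* ((a :+ b) :+ (a :+ b :+ b)) := con 3 :* (a :+ b) :+ (a :+ con 3 :* b))
                       refl (oddFib m) (evenFib m)

  -- F(2k+2) ≥ 2^k, since F(2k+4) ≥ 2F(2k+2).
  pow≤evenFib : ∀ k → 2 ^ k ≤ evenFib (suc k)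
  pow≤evenFib zero    = s≤s z≤n
  pow≤evenFib (suc k) = begin
    2 * 2 ^ k                  ≡⟨ solve 1 (λ p → con 2 :* p := p :+ p) refl (2 ^ k) ⟩
    2 ^ k + 2 ^ k              ≤⟨ +-mono-≤ (pow≤evenFib k) (pow≤evenFib k) ⟩
    evenFib (suc k) + evenFib (suc k)
                               ≤⟨ +-monoˡ-≤ (evenFib (suc k)) (m≤n+m (evenFib (suc k)) (oddFib (suc k))) ⟩
    evenFib (suc (suc k)) ∎
    where open ≤-Reasoning

  -- 4F(2m+1) ≥ m·2^m, using F(2k+5) = 2F(2k+3) + F(2k+2) and the previous bound.
  growth : ∀ m → m * 2 ^ m ≤ 4 * oddFib (suc m)
  growth zero          = z≤n
  growth (suc zero)    = s≤s (s≤s z≤n)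
  growth (suc (suc k)) = begin
    suc (suc k) * (2 * 2 ^ suc k)
      ≡⟨ solve 2 (λ k q → (con 2 :+ k) :* (con 2 :* (con 2 :* q)) := con 2 :* ((con 1 :+ k) :* (con 2 :* q)) :+ con 4 :* q)
               refl k (2 ^ k) ⟩
    2 * (suc k * 2 ^ suc k) + 4 * 2 ^ k
      ≤⟨ +-mono-≤ (*-monoʳ-≤ 2 (growth (suc k))) (*-monoʳ-≤ 4 (pow≤evenFib k)) ⟩
    2 * (4 * oddFib (suc (suc k))) + 4 * evenFib (suc k)
      ≡⟨ solve 2 (λ a b → con 2 :* (con 4 :* ((a :+ b) :+ (a :+ b :+ b))) :+ con 4 :* (a :+ b :+ b)
                        := con 4 :* (((a :+ b) :+ (a :+ b :+ b)) :+ ((a :+ b) :+ (a :+ b :+ b) :+ (a :+ b :+ b))))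
               refl (oddFib k) (evenFib k) ⟩
    4 * oddFib (suc (suc (suc k))) ∎
    where open ≤-Reasoning

  oddFib-dominates : ∀ c m → 4 * c < m → c * 2 ^ m < oddFib (suc m)
  oddFib-dominates c m 4c<m = *-cancelˡ-< 4 (c * 2 ^ m) (oddFib (suc m)) (begin-strict
    4 * (c * 2 ^ m)    ≡⟨ sym (*-assoc 4 c (2 ^ m)) ⟩
    4 * c * 2 ^ m      <⟨ *-monoˡ-< (2 ^ m) {{m^n≢0 2 m}} 4c<m ⟩
    m * 2 ^ m          ≤⟨ growth m ⟩
    4 * oddFib (suc m) ∎)
    where open ≤-Reasoning

module PellApproximation where

  open import Data.Nat using (ℕ; zero; suc; _+_; _*_; _≤_; _<_; z≤n; s≤s; _∸_; _≤?_)
  open import Data.Nat.Properties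
  open import Data.Nat.Solver using (module +-*-Solver)
  open import Data.Empty using (⊥-elim)
  open import Relation.Nullary using (yes; no)
  open import Relation.Binary.PropositionalEquality using (_≡_; refl; sym; trans; cong; subst)
  open +-*-Solver

  pell-below : ∀ {X d b g} → d * d + 4 ≡ 5 * (X * X) → 5 * (b * b) < g * g → b * d < g * X
  pell-below {zero} {d} eq _ with m+n≡0⇒n≡0 (d * d) eq
  ... | ()
  pell-below {X@(suc _)} {d} {b} {g} eq 5b²<g² = ≰⇒> λ gX≤bd → <-irrefl refl (begin-strict
    5 * (b * b) * (X * X)           <⟨ *-monoˡ-< (X * X) 5b²<g² ⟩
    g * g * (X * X)                 ≡⟨ solve 2 (λ g X → g :* g :* (X :* X) := (g :* X) :* (g :* X)) refl g X ⟩
    (g * X) * (g * X)               ≤⟨ *-mono-≤ gX≤bd gX≤bd ⟩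
    (b * d) * (b * d)               ≤⟨ m≤m+n _ (4 * (b * b)) ⟩
    (b * d) * (b * d) + 4 * (b * b) ≡⟨ solve 2 (λ b d → (b :* d) :* (b :* d) :+ con 4 :* (b :* b)
                                                      := b :* b :* (d :* d :+ con 4)) refl b d ⟩
    b * b * (d * d + 4)             ≡⟨ cong (b * b *_) eq ⟩
    b * b * (5 * (X * X))           ≡⟨ solve 2 (λ b X → b :* b :* (con 5 :* (X :* X)) := con 5 :* (b :* b) :* (X :* X)) refl b X ⟩
    5 * (b * b) * (X * X)           ∎)
    where open ≤-Reasoning

  below√5⇒≤3 : ∀ {b g} → g * g < 5 * (b * b) → g ≤ 3 * b
  below√5⇒≤3 {b} {g} g²<5b² = ≮⇒≥ λ 3b<g → <-asym g²<5b² (begin-strict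
    5 * (b * b)        ≤⟨ *-monoˡ-≤ (b * b) (s≤s (s≤s (s≤s (s≤s (s≤s (z≤n {4})))))) ⟩
    9 * (b * b)        ≡⟨ solve 1 (λ b → con 9 :* (b :* b) := (con 3 :* b) :* (con 3 :* b)) refl b ⟩
    (3 * b) * (3 * b)  <⟨ *-mono-< 3b<g 3b<g ⟩
    g * g              ∎)
    where open ≤-Reasoning

  -- Squaring the assumption b·d ≤ g·X + 2bP and using the Pell equation
  -- leaves X² bounded by the cross terms.
  pell-square-bound : ∀ {X d b g P} → d * d + 4 ≡ 5 * (X * X) → g * g < 5 * (b * b)
    → b * d ≤ g * X + 2 * b * P
    → X * X ≤ 4 * (g * (b * P * X)) + 4 * (b * b * P * P) + 4 * (b * b)
  pell-square-bound {X} {d} {b} {g} {P} eq g²<5b² bd≤R = +-cancelˡ-≤ (g * g * (X * X)) _ _ (begin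
    g * g * (X * X) + X * X             ≡⟨ +-comm (g * g * (X * X)) (X * X) ⟩
    suc (g * g) * (X * X)               ≤⟨ *-monoˡ-≤ (X * X) g²<5b² ⟩
    5 * (b * b) * (X * X)               ≡⟨ solve 2 (λ b X → con 5 :* (b :* b) :* (X :* X) := b :* b :* (con 5 :* (X :* X))) refl b X ⟩
    b * b * (5 * (X * X))               ≡⟨ cong (b * b *_) (sym eq) ⟩
    b * b * (d * d + 4)                 ≡⟨ solve 2 (λ b d → b :* b :* (d :* d :+ con 4) := (b :* d) :* (b :* d) :+ con 4 :* (b :* b)) refl b d ⟩
    (b * d) * (b * d) + 4 * (b * b)     ≤⟨ +-monoˡ-≤ (4 * (b * b)) (*-mono-≤ bd≤R bd≤R) ⟩
    R * R + 4 * (b * b)                 ≡⟨ solve 4 (λ g X b P → (g :* X :+ con 2 :* b :* P) :* (g :* X :+ con 2 :* b :* P) :+ con 4 :* (b :* b)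
                                                   := g :* g :* (X :* X) :+ (con 4 :* (g :* (b :* P :* X)) :+ con 4 :* (b :* b :* P :* P) :+ con 4 :* (b :* b)))
                                                refl g X b P ⟩
    g * g * (X * X) + (4 * (g * (b * P * X)) + 4 * (b * b * P * P) + 4 * (b * b)) ∎)
    where
    open ≤-Reasoning
    R : ℕ
    R = g * X + 2 * b * P

  pell-gap : ∀ {X d b g P} → d * d + 4 ≡ 5 * (X * X) → g * g < 5 * (b * b) → 1 ≤ P
    → 20 * (b * b * P) < X → g * X + 2 * b * P < b * d
  pell-gap {b = zero} _ ()
  pell-gap {zero} _ _ _ ()
  pell-gap {X@(suc _)} {d} {b@(suc _)} {g} {P} eq g²<5b² 1≤P big = ≰⇒> λ bd≤R → <-irrefl refl (begin-strict
    20 * Q * X                                                <⟨ *-monoˡ-< X big ⟩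
    X * X                                                     ≤⟨ pell-square-bound {X} {d} {b} {g} {P} eq g²<5b² bd≤R ⟩
    4 * (g * (b * P * X)) + 4 * (b * b * P * P) + 4 * (b * b) ≤⟨ +-mono-≤ (+-mono-≤ cross square) constant ⟩
    4 * (3 * (Q * X)) + 4 * (Q * X) + 4 * (Q * X)            ≡⟨ solve 2 (λ q X → con 4 :* (con 3 :* (q :* X)) :+ con 4 :* (q :* X) :+ con 4 :* (q :* X) := con 20 :* q :* X) refl Q X ⟩
    20 * Q * X                                                ∎)
    where
    open ≤-Reasoning
    Q : ℕ
    Q = b * b * P
    P≤X : P ≤ X
    P≤X = <⇒≤ (≤-<-trans (m≤n*m P (20 * (b * b))) (subst (_< X) (sym (*-assoc 20 (b * b) P)) big))
    cross : 4 * (g * (b * P * X)) ≤ 4 * (3 * (Q * X))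
    cross = *-monoʳ-≤ 4 (subst (g * (b * P * X) ≤_) (solve 3 (λ b P X → con 3 :* b :* (b :* P :* X) := con 3 :* (b :* b :* P :* X)) refl b P X)
                                                    (*-monoˡ-≤ (b * P * X) (below√5⇒≤3 {b} {g} g²<5b²)))
    square : 4 * (b * b * P * P) ≤ 4 * (Q * X)
    square = *-monoʳ-≤ 4 (*-monoʳ-≤ Q P≤X)
    constant : 4 * (b * b) ≤ 4 * (Q * X)
    constant = *-monoʳ-≤ 4 (begin
      b * b           ≡⟨ sym (*-identityʳ (b * b)) ⟩
      b * b * 1       ≤⟨ *-monoʳ-≤ (b * b) (*-mono-≤ 1≤P (s≤s z≤n)) ⟩
      b * b * (P * X) ≡⟨ sym (*-assoc (b * b) P X) ⟩
      Q * X           ∎)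

  -- Let (X, d) solve d² + 4 = 5X² and put Z = (3X + d)/2, so that Z/X approximates
  -- α² = (3 + √5)/2 from below.  Writing g = 2n ∸ 3b, the condition n/b > α²
  -- reads 5b² < g², and then Z/X < n/b.
  ratio-below : ∀ {X d Z n b} → d * d + 4 ≡ 5 * (X * X) → 2 * Z ≡ 3 * X + d
    → 5 * (b * b) < (2 * n ∸ 3 * b) * (2 * n ∸ 3 * b) → Z * b < n * X
  ratio-below {X} {d} {Z} {n} {b} eq half above with 3 * b ≤? 2 * n
  ... | no 2n<3b rewrite m≤n⇒m∸n≡0 (<⇒≤ (≰⇒> 2n<3b)) = ⊥-elim (n≮0 above)
  ... | yes 3b≤2n = *-cancelˡ-< 2 (Z * b) (n * X) (begin-strict
    2 * (Z * b)     ≡⟨ sym (*-assoc 2 Z b) ⟩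
    2 * Z * b       ≡⟨ cong (_* b) half ⟩
    (3 * X + d) * b ≡⟨ solve 3 (λ X d b → (con 3 :* X :+ d) :* b := con 3 :* b :* X :+ b :* d) refl X d b ⟩
    3 * b * X + b * d
                    <⟨ +-monoʳ-< (3 * b * X) (pell-below {X} {d} {b} {g} eq above) ⟩
    3 * b * X + g * X
                    ≡⟨ sym (*-distribʳ-+ X (3 * b) g) ⟩
    (3 * b + g) * X ≡⟨ cong (_* X) (m+[n∸m]≡n 3b≤2n) ⟩
    2 * n * X       ≡⟨ *-assoc 2 n X ⟩
    2 * (n * X)     ∎)
    where
    open ≤-Reasoning
    g : ℕ
    g = 2 * n ∸ 3 * b

  ratio-above : ∀ {X d Z S P n b} → d * d + 4 ≡ 5 * (X * X) → 2 * Z ≡ 3 * X + d → S + P ≡ Z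
    → (2 * n ∸ 3 * b) * (2 * n ∸ 3 * b) < 5 * (b * b) → 1 ≤ P → 20 * (b * b * P) < X
    → n * X < S * b
  ratio-above {X} {d} {Z} {S} {P} {n} {b} eq half split below 1≤P big =
    *-cancelˡ-< 2 (n * X) (S * b) (+-cancelʳ-< (2 * b * P) (2 * (n * X)) (2 * (S * b)) (begin-strict
    2 * (n * X) + 2 * b * P      ≡⟨ cong (_+ 2 * b * P) (sym (*-assoc 2 n X)) ⟩
    2 * n * X + 2 * b * P        ≤⟨ +-monoˡ-≤ (2 * b * P) (*-monoˡ-≤ X (m≤n+m∸n (2 * n) (3 * b))) ⟩
    (3 * b + g) * X + 2 * b * P  ≡⟨ solve 4 (λ b g X P → (con 3 :* b :+ g) :* X :+ con 2 :* b :* P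
                                                       := con 3 :* b :* X :+ (g :* X :+ con 2 :* b :* P)) refl b g X P ⟩
    3 * b * X + (g * X + 2 * b * P)
                                 <⟨ +-monoʳ-< (3 * b * X) (pell-gap {X} {d} {b} {g} {P} eq below 1≤P big) ⟩
    3 * b * X + b * d            ≡⟨ solve 3 (λ X d b → con 3 :* b :* X :+ b :* d := (con 3 :* X :+ d) :* b) refl X d b ⟩
    (3 * X + d) * b              ≡⟨ cong (_* b) (trans (sym half) (cong (2 *_) (sym split))) ⟩
    2 * (S + P) * b              ≡⟨ solve 3 (λ S P b → con 2 :* (S :+ P) :* b := con 2 :* (S :* b) :+ con 2 :* b :* P) refl S P b ⟩
    2 * (S * b) + 2 * b * P      ∎))
    where
    open ≤-Reasoning
    g : ℕ
    g = 2 * n ∸ 3 * b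

module Elenas where

  open import Defs
  open import Data.Nat using (ℕ; zero; suc; _+_; _*_; _^_)
  open import Data.Nat.Properties using (+-identityʳ; +-assoc)
  open import Data.Nat.ListAction using (sum)
  open import Data.Nat.ListAction.Properties using (sum-++; sum-↭)
  open import Data.Nat.Solver using (module +-*-Solver)
  open import Data.List using (List; []; _∷_; [_]; _++_; length; map)
  open import Data.List.Properties using (length-++; length-map; map-++)
  open import Data.List.Relation.Unary.All using (All; []; _∷_)
  open import Data.List.Relation.Unary.Any using (here)
  open import Data.List.Relation.Unary.AllPairs using ([]; _∷_)
  open import Data.List.Membership.Propositional using (_∈_)
  open import Data.List.Membership.Propositional.Properties
    using (∈-++⁺ˡ; ∈-++⁺ʳ; ∈-++⁻; ∈-map⁺; ∈-map⁻)
  open import Data.List.Membership.Propositional.Properties.WithK using (unique∧set⇒bag)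
  open import Data.List.Relation.Unary.Unique.Propositional using (Unique)
  import Data.List.Relation.Unary.Unique.Propositional.Properties as Unique
  open import Data.List.Relation.Binary.BagAndSetEquality using (∼bag⇒↭)
  open import Data.List.Relation.Binary.Permutation.Propositional using (_↭_)
  import Data.List.Relation.Binary.Permutation.Propositional.Properties as Perm
  open import Data.Product using (_×_; _,_; proj₁; proj₂; map₂)
  open import Data.Sum using ([_,_]′)
  open import Data.Unit using (⊤; tt)
  open import Function using (_∘_)
  open import Data.Empty using (⊥; ⊥-elim)
  open import Relation.Nullary using (¬_)
  open import Function.Bundles using (_⇔_; mk⇔; Equivalence)
  open import Relation.Binary.PropositionalEquality
    using (_≡_; refl; sym; trans; cong; cong₂; subst; module ≡-Reasoning)
  open Fibonacci using (oddFib; evenFib)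

  data Spine : PTree → Set where
    done    : Spine (node [])
    descend : ∀ {t} → Spine t → Spine (node [ t ])
    beside  : ∀ {p d ds} → IsPath p → Spine (node (d ∷ ds)) → Spine (node (p ∷ d ∷ ds))

  toSpine : ∀ {t} → IsElena t → Spine t
  toSpine leaf          = done
  toSpine (branch ps e) = paths ps (toSpine e)
    where
    paths : ∀ {ps t} → All IsPath ps → Spine t → Spine (node (ps ++ [ t ]))
    paths []            s = descend s
    paths (p ∷ [])      s = beside p (descend s)
    paths (p ∷ q ∷ qs)  s = beside p (paths (q ∷ qs) s)

  prependPath : ∀ {p cs} → IsPath p → IsElena (node cs) → ¬ cs ≡ [] → IsElena (node (p ∷ cs))
  prependPath p leaf          cs≢[] = ⊥-elim (cs≢[] refl)
  prependPath p (branch ps e) _     = branch (p ∷ ps) e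

  fromSpine : ∀ {t} → Spine t → IsElena t
  fromSpine done         = leaf
  fromSpine (descend s)  = branch [] (fromSpine s)
  fromSpine (beside p s) = prependPath p (fromSpine s) (λ ())

  ElenaOfSize : ℕ → PTree → Set
  ElenaOfSize n t = Spine t × size t ≡ n

  data HasChild : PTree → Set where
    hasChild : ∀ {c cs} → HasChild (node (c ∷ cs))

  data HasTwoChildren : PTree → Set where
    hasTwo : ∀ {c d ds} → HasTwoChildren (node (c ∷ d ∷ ds))

  plant : PTree → PTree
  plant t = node [ t ]

  addLeafPath : PTree → PTree
  addLeafPath (node cs) = node (node [] ∷ cs)

  extendPath : PTree → PTree
  extendPath (node [])       = node []
  extendPath (node (c ∷ cs)) = node (plant c ∷ cs)

  -- Every Elena with at least two root children arises
  -- exactly once by addLeafPath (leftmost path has one node) or extendPath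
  -- (leftmost path is longer); every other non-leaf Elena is a planted one.
  leafOfSize : ℕ → List PTree
  leafOfSize 1 = [ node [] ]
  leafOfSize _ = []

  enum          : ℕ → List PTree
  enumNonLeaf   : ℕ → List PTree
  enumBranching : ℕ → List PTree

  enum n = leafOfSize n ++ enumNonLeaf n

  enumNonLeaf zero    = []
  enumNonLeaf (suc n) = map plant (enum n) ++ enumBranching (suc n)

  enumBranching zero    = []
  enumBranching (suc n) = map addLeafPath (enumNonLeaf n) ++ map extendPath (enumBranching n)

  size-plant : ∀ t → size (plant t) ≡ suc (size t)
  size-plant t = cong suc (+-identityʳ (size t))

  plant-sound : ∀ {n u} → ElenaOfSize n u → ElenaOfSize (suc n) (plant u) × HasChild (plant u)
  plant-sound {u = u} (s , refl) = (descend s , size-plant u) , hasChild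

  addLeafPath-sound : ∀ {n u} → ElenaOfSize n u × HasChild u
    → ElenaOfSize (suc n) (addLeafPath u) × HasTwoChildren (addLeafPath u)
  addLeafPath-sound ((s , refl) , hasChild) = (beside leaf s , refl) , hasTwo

  extendPath-sound : ∀ {n u} → ElenaOfSize n u × HasTwoChildren u
    → ElenaOfSize (suc n) (extendPath u) × HasTwoChildren (extendPath u)
  extendPath-sound {u = node (c ∷ d ∷ ds)} ((beside p s , refl) , hasTwo) =
    (beside (step p) s , cong (λ k → suc (suc k + sizes (d ∷ ds))) (+-identityʳ (size c))) , hasTwo

  ∈-map-elim : ∀ {A B : Set} {P : B → Set} (f : A → B) {xs t} → (∀ {u} → u ∈ xs → P (f u)) → t ∈ map f xs → P t
  ∈-map-elim f k t∈ with ∈-map⁻ f t∈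
  ... | _ , u∈ , refl = k u∈

  twoChildren⇒child : ∀ {t} → HasTwoChildren t → HasChild t
  twoChildren⇒child hasTwo = hasChild

  leaf-sound : ∀ n {t} → t ∈ leafOfSize n → ElenaOfSize n t × t ≡ node []
  leaf-sound 1 (here refl) = (done , refl) , refl

  enum-sound      : ∀ n {t} → t ∈ enum n → ElenaOfSize n t
  nonLeaf-sound   : ∀ n {t} → t ∈ enumNonLeaf n → ElenaOfSize n t × HasChild t
  branching-sound : ∀ n {t} → t ∈ enumBranching n → ElenaOfSize n t × HasTwoChildren t

  enum-sound n t∈ = [ proj₁ ∘ leaf-sound n , proj₁ ∘ nonLeaf-sound n ]′ (∈-++⁻ (leafOfSize n) t∈)

  nonLeaf-sound (suc n) t∈ =
    [ ∈-map-elim {P = λ t → ElenaOfSize (suc n) t × HasChild t} plant (plant-sound ∘ enum-sound n)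
    , map₂ twoChildren⇒child ∘ branching-sound (suc n)
    ]′ (∈-++⁻ (map plant (enum n)) t∈)

  branching-sound (suc n) t∈ =
    [ ∈-map-elim {P = Sound} addLeafPath (addLeafPath-sound ∘ nonLeaf-sound n)
    , ∈-map-elim {P = Sound} extendPath (extendPath-sound ∘ branching-sound n)
    ]′ (∈-++⁻ (map addLeafPath (enumNonLeaf n)) t∈)
    where Sound = λ t → ElenaOfSize (suc n) t × HasTwoChildren t

  enum-complete      : ∀ {t} → Spine t → t ∈ enum (size t)
  nonLeaf-complete   : ∀ {t} → Spine t → HasChild t → t ∈ enumNonLeaf (size t)
  branching-complete : ∀ {t} → Spine t → HasTwoChildren t → t ∈ enumBranching (size t)

  enum-complete done             = here refl
  enum-complete {t} s@(descend _)  = ∈-++⁺ʳ (leafOfSize (size t)) (nonLeaf-complete s hasChild)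
  enum-complete {t} s@(beside _ _) = ∈-++⁺ʳ (leafOfSize (size t)) (nonLeaf-complete s hasChild)

  nonLeaf-complete (descend {t} s) hasChild =
    ∈-++⁺ˡ (∈-map⁺ plant (subst (λ k → t ∈ enum k) (sym (+-identityʳ (size t))) (enum-complete s)))
  nonLeaf-complete {node cs} s@(beside _ _) hasChild =
    ∈-++⁺ʳ (map plant (enum (sizes cs))) (branching-complete s hasTwo)

  branching-complete (beside leaf s) hasTwo =
    ∈-++⁺ˡ (∈-map⁺ addLeafPath (nonLeaf-complete s hasChild))
  branching-complete (beside {d = d} {ds} (step {c} p) s) hasTwo =
    ∈-++⁺ʳ (map addLeafPath (enumNonLeaf (suc (size c + 0 + sizes (d ∷ ds))))) (∈-map⁺ extendPath
      (subst (λ k → node (c ∷ d ∷ ds) ∈ enumBranching k)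
             (cong (λ k → suc (k + sizes (d ∷ ds))) (sym (+-identityʳ (size c))))
             (branching-complete (beside p s) hasTwo)))

  plant-injective : ∀ {x y} → plant x ≡ plant y → x ≡ y
  plant-injective refl = refl

  addLeafPath-injective : ∀ {x y} → addLeafPath x ≡ addLeafPath y → x ≡ y
  addLeafPath-injective {node _} {node _} refl = refl

  extendPath-injective : ∀ {x y} → extendPath x ≡ extendPath y → x ≡ y
  extendPath-injective {node []}      {node []}      refl = refl
  extendPath-injective {node (_ ∷ _)} {node (_ ∷ _)} refl = refl

  leafOfSize-unique : ∀ n → Unique (leafOfSize n)
  leafOfSize-unique zero          = []
  leafOfSize-unique (suc zero)    = [] ∷ []
  leafOfSize-unique (suc (suc n)) = []

  enum-unique      : ∀ n → Unique (enum n)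
  nonLeaf-unique   : ∀ n → Unique (enumNonLeaf n)
  branching-unique : ∀ n → Unique (enumBranching n)

  enum-unique n = Unique.++⁺ (leafOfSize-unique n) (nonLeaf-unique n) disjoint
    where
    disjoint : ∀ {t} → ¬ (t ∈ leafOfSize n × t ∈ enumNonLeaf n)
    disjoint (t∈₁ , t∈₂) with leaf-sound n t∈₁ | nonLeaf-sound n t∈₂
    ... | _ , refl | _ , ()

  nonLeaf-unique zero    = []
  nonLeaf-unique (suc n) =
    Unique.++⁺ (Unique.map⁺ plant-injective (enum-unique n)) (branching-unique (suc n)) disjoint
    where
    disjoint : ∀ {t} → ¬ (t ∈ map plant (enum n) × t ∈ enumBranching (suc n))
    disjoint (t∈₁ , t∈₂) =
      ∈-map-elim {P = λ t → ¬ HasTwoChildren t} plant (λ _ ()) t∈₁ (proj₂ (branching-sound (suc n) t∈₂))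

  branching-unique zero    = []
  branching-unique (suc n) =
    Unique.++⁺ (Unique.map⁺ addLeafPath-injective (nonLeaf-unique n))
               (Unique.map⁺ extendPath-injective (branching-unique n)) disjoint
    where
    -- the leftmost child is a single node in the first image, a longer path in the second
    LeftmostIsLeaf : PTree → Set
    LeftmostIsLeaf (node (node [] ∷ _)) = ⊤
    LeftmostIsLeaf _                    = ⊥
    notLeftmostLeaf : ∀ {u} → HasTwoChildren u → ¬ LeftmostIsLeaf (extendPath u)
    notLeftmostLeaf hasTwo ()
    disjoint : ∀ {t} → ¬ (t ∈ map addLeafPath (enumNonLeaf n) × t ∈ map extendPath (enumBranching n))
    disjoint (t∈₁ , t∈₂) =
      ∈-map-elim {P = λ t → ¬ LeftmostIsLeaf t} extendPath
        (λ u∈ → notLeftmostLeaf (proj₂ (branching-sound n u∈))) t∈₂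
        (∈-map-elim {P = LeftmostIsLeaf} addLeafPath (λ { {node _} _ → tt }) t∈₁)

  enum-spec : ∀ n t → t ∈ enum n ⇔ (IsElena t × size t ≡ n)
  enum-spec n t = mk⇔ (λ t∈ → fromSpine (proj₁ (enum-sound n t∈)) , proj₂ (enum-sound n t∈))
                      (λ { (e , refl) → enum-complete (toSpine e) })

  sameMembers⇒↭ : ∀ {A : Set} {xs ys : List A} → Unique xs → Unique ys → (∀ t → t ∈ xs ⇔ t ∈ ys) → xs ↭ ys
  sameMembers⇒↭ uxs uys same = ∼bag⇒↭ (unique∧set⇒bag uxs uys (λ {t} → same t))

  rootChildSum : List PTree → ℕ
  rootChildSum ts = sum (map rootChildren ts)

  rootChildSum-++ : ∀ xs ys → rootChildSum (xs ++ ys) ≡ rootChildSum xs + rootChildSum ys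
  rootChildSum-++ xs ys =
    trans (cong sum (map-++ rootChildren xs ys)) (sum-++ (map rootChildren xs) (map rootChildren ys))

  rootChildSum-plant : ∀ xs → rootChildSum (map plant xs) ≡ length xs
  rootChildSum-plant []       = refl
  rootChildSum-plant (_ ∷ xs) = cong suc (rootChildSum-plant xs)

  rootChildSum-addLeafPath : ∀ xs → rootChildSum (map addLeafPath xs) ≡ length xs + rootChildSum xs
  rootChildSum-addLeafPath []             = refl
  rootChildSum-addLeafPath (node cs ∷ xs) =
    trans (cong (suc (length cs) +_) (rootChildSum-addLeafPath xs))
          (solve 3 (λ c l r → con 1 :+ c :+ (l :+ r) := con 1 :+ l :+ (c :+ r)) refl (length cs) (length xs) (rootChildSum xs))
    where open +-*-Solver

  rootChildSum-extendPath : ∀ xs → rootChildSum (map extendPath xs) ≡ rootChildSum xs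
  rootChildSum-extendPath []                   = refl
  rootChildSum-extendPath (node []       ∷ xs) = rootChildSum-extendPath xs
  rootChildSum-extendPath (node (_ ∷ cs) ∷ xs) = cong (suc (length cs) +_) (rootChildSum-extendPath xs)

  length-enum      : ∀ m → length (enum (suc m)) ≡ oddFib m
  length-nonLeaf   : ∀ m → length (enumNonLeaf (suc (suc m))) ≡ oddFib (suc m)
  length-branching : ∀ m → length (enumBranching (suc (suc m))) ≡ evenFib m

  length-enum zero    = refl
  length-enum (suc m) = length-nonLeaf m

  length-nonLeaf m =
    trans (length-++ (map plant (enum (suc m))))
          (cong₂ _+_ (trans (length-map plant (enum (suc m))) (length-enum m)) (length-branching m))

  length-branching zero    = refl
  length-branching (suc m) =
    trans (length-++ (map addLeafPath (enumNonLeaf (suc (suc m)))))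
          (cong₂ _+_ (trans (length-map addLeafPath (enumNonLeaf (suc (suc m)))) (length-nonLeaf m))
                     (trans (length-map extendPath (enumBranching (suc (suc m)))) (length-branching m)))

  rootChildSum-nonLeaf   : ∀ m → rootChildSum (enumNonLeaf (suc (suc m))) + 2 ^ m ≡ oddFib (suc (suc m))
  rootChildSum-branching : ∀ m → rootChildSum (enumBranching (suc (suc m))) + 2 ^ m ≡ evenFib m + evenFib (suc m)

  rootChildSum-nonLeaf zero    = refl
  rootChildSum-nonLeaf (suc m) = begin
    rootChildSum (map plant E ++ Br) + 2 ^ suc m
      ≡⟨ cong (_+ 2 ^ suc m) (rootChildSum-++ (map plant E) Br) ⟩
    rootChildSum (map plant E) + rootChildSum Br + 2 ^ suc m
      ≡⟨ +-assoc (rootChildSum (map plant E)) _ _ ⟩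
    rootChildSum (map plant E) + (rootChildSum Br + 2 ^ suc m)
      ≡⟨ cong₂ _+_ (trans (rootChildSum-plant E) (length-enum (suc m))) (rootChildSum-branching (suc m)) ⟩
    oddFib (suc m) + (evenFib (suc m) + evenFib (suc (suc m)))
      ≡⟨ sym (+-assoc (oddFib (suc m)) _ _) ⟩
    oddFib (suc (suc (suc m))) ∎
    where
    open ≡-Reasoning
    E Br : List PTree
    E  = enum (suc (suc m))
    Br = enumBranching (suc (suc (suc m)))

  rootChildSum-branching zero    = refl
  rootChildSum-branching (suc m) = begin
    rootChildSum (map addLeafPath NL ++ map extendPath Br) + 2 ^ suc m
      ≡⟨ cong (_+ 2 ^ suc m) (trans (rootChildSum-++ (map addLeafPath NL) (map extendPath Br))
                                     (cong₂ _+_ (rootChildSum-addLeafPath NL) (rootChildSum-extendPath Br))) ⟩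
    length NL + rootChildSum NL + rootChildSum Br + 2 * 2 ^ m
      ≡⟨ solve 4 (λ l n b p → l :+ n :+ b :+ con 2 :* p := l :+ (n :+ p) :+ (b :+ p))
               refl (length NL) (rootChildSum NL) (rootChildSum Br) (2 ^ m) ⟩
    length NL + (rootChildSum NL + 2 ^ m) + (rootChildSum Br + 2 ^ m)
      ≡⟨ cong₂ _+_ (cong₂ _+_ (length-nonLeaf m) (rootChildSum-nonLeaf m)) (rootChildSum-branching m) ⟩
    oddFib (suc m) + oddFib (suc (suc m)) + (evenFib m + evenFib (suc m))
      ≡⟨ solve 2 (λ a b → (a :+ b) :+ ((a :+ b) :+ (a :+ b :+ b)) :+ (b :+ (a :+ b :+ b))
                        := (a :+ b :+ b) :+ ((a :+ b) :+ (a :+ b :+ b) :+ (a :+ b :+ b)))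
               refl (oddFib m) (evenFib m) ⟩
    evenFib (suc m) + evenFib (suc (suc m)) ∎
    where
    open ≡-Reasoning
    open +-*-Solver
    NL Br : List PTree
    NL = enumNonLeaf (suc (suc m))
    Br = enumBranching (suc (suc m))

  module _ (elenas : ℕ → List PTree)
           (unique : ∀ n → Unique (elenas n))
           (spec : ∀ n t → (t ∈ elenas n) ⇔ (IsElena t × size t ≡ n)) where

    elenas↭enum : ∀ n → elenas n ↭ enum n
    elenas↭enum n = sameMembers⇒↭ (unique n) (enum-unique n) same
      where
      same : ∀ t → t ∈ elenas n ⇔ t ∈ enum n
      same t = mk⇔ (Equivalence.from (enum-spec n t) ∘ Equivalence.to (spec n t))
                   (Equivalence.from (spec n t) ∘ Equivalence.to (enum-spec n t))

    count-elenas : ∀ m → count (elenas (suc (suc m))) ≡ ℕ→ℚ (oddFib (suc m))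
    count-elenas m = cong ℕ→ℚ (trans (Perm.↭-length (elenas↭enum (suc (suc m)))) (length-enum (suc m)))

    total-elenas : ∀ m → totalRootChildren (elenas (suc (suc m))) ≡ ℕ→ℚ (rootChildSum (enumNonLeaf (suc (suc m))))
    total-elenas m = cong ℕ→ℚ (sum-↭ (Perm.map⁺ rootChildren (elenas↭enum (suc (suc m)))))

module RationalEstimates where

  open import Defs
  open import Data.Nat as ℕ using (ℕ; suc; _∸_)
  import Data.Nat.Properties as ℕ
  open import Data.Integer as ℤ using (ℤ; +_; -[1+_]; +<+; -<+; 0ℤ; _⊖_)
  open import Data.Integer.Properties using (pos-*; m-n≡m⊖n; ⊖-≥; ⊖-≤; drop‿+<+)
  import Data.Integer.Properties as ℤ
  import Data.Integer.Solver
  open import Data.Rational using (ℚ; mkℚ; ↧ₙ_; toℚᵘ; _*_; _-_; -_; _<_)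
  open import Data.Rational.Properties using (toℚᵘ-homo-*; toℚᵘ-homo-+; toℚᵘ-homo‿-; toℚᵘ-fromℚᵘ; toℚᵘ-mono-<; toℚᵘ-cancel-<)
  open import Data.Rational.Unnormalised as ℚᵘ using (mkℚᵘ; *≡*; *<*; _≃_)
  open import Data.Rational.Unnormalised.Properties using (≃-refl; ≃-sym; ≃-trans; *-cong; +-cong; -‿cong; <-respˡ-≃; <-respʳ-≃)
  open import Data.Nat.Coprimality using (Coprime)
  open import Data.Product using (_×_; _,_; ∃-syntax)
  open import Data.Sum using (_⊎_; inj₁; inj₂)
  open import Data.Empty using (⊥-elim)
  open import Relation.Nullary using (yes; no)
  open import Relation.Binary.PropositionalEquality using (_≡_; refl; sym; trans; cong; cong₂; subst; subst₂)
  open PellApproximation using (ratio-below; ratio-above)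

  toℚᵘ-ℕ→ℚ : ∀ n → toℚᵘ (ℕ→ℚ n) ≃ mkℚᵘ (+ n) 0
  toℚᵘ-ℕ→ℚ n = toℚᵘ-fromℚᵘ (mkℚᵘ (+ n) 0)

  toℚᵘ-scaled : ∀ a dm .(c : Coprime ℤ.∣ a ∣ (suc dm)) X → toℚᵘ (mkℚ a dm c * ℕ→ℚ X) ≃ mkℚᵘ (a ℤ.* + X) dm
  toℚᵘ-scaled a dm c X = ≃-trans (toℚᵘ-homo-* (mkℚ a dm c) (ℕ→ℚ X))
    (≃-trans (*-cong (≃-refl {mkℚᵘ a dm}) (toℚᵘ-ℕ→ℚ X))
             (*≡* (cong (λ k → a ℤ.* + X ℤ.* + suc k) (sym (ℕ.*-identityʳ dm)))))

  scaled<ℕ : ∀ a dm .(c : Coprime ℤ.∣ a ∣ (suc dm)) {X S}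
    → a ℤ.* + X ℤ.< + S ℤ.* + suc dm → mkℚ a dm c * ℕ→ℚ X < ℕ→ℚ S
  scaled<ℕ a dm c {X} {S} lt = toℚᵘ-cancel-<
    (<-respˡ-≃ (≃-sym (toℚᵘ-scaled a dm c X)) (<-respʳ-≃ (≃-sym (toℚᵘ-ℕ→ℚ S))
      (*<* (subst (ℤ._< _) (sym (ℤ.*-identityʳ (a ℤ.* + X))) lt))))

  ℕ<scaled : ∀ a dm .(c : Coprime ℤ.∣ a ∣ (suc dm)) {X S}
    → + S ℤ.* + suc dm ℤ.< a ℤ.* + X → ℕ→ℚ S < mkℚ a dm c * ℕ→ℚ X
  ℕ<scaled a dm c {X} {S} lt = toℚᵘ-cancel-<
    (<-respʳ-≃ (≃-sym (toℚᵘ-scaled a dm c X)) (<-respˡ-≃ (≃-sym (toℚᵘ-ℕ→ℚ S))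
      (*<* (subst (_ ℤ.<_) (sym (ℤ.*-identityʳ (a ℤ.* + X))) lt))))

  ℕ-products< : ∀ m n o p → m ℕ.* n ℕ.< o ℕ.* p → + m ℤ.* + n ℤ.< + o ℤ.* + p
  ℕ-products< m n o p lt = subst₂ ℤ._<_ (pos-* m n) (pos-* o p) (+<+ lt)

  -- The numerator 2a − 3b of 2q − 3 for q = a/b.
  numer : ℤ → ℕ → ℤ
  numer a b = + 2 ℤ.* a ℤ.- + 3 ℤ.* + b

  toℚᵘ-2q-3 : ∀ a dm .(c : Coprime ℤ.∣ a ∣ (suc dm)) → toℚᵘ (ℕ→ℚ 2 * mkℚ a dm c - ℕ→ℚ 3) ≃ mkℚᵘ (numer a (suc dm)) dm
  toℚᵘ-2q-3 a dm c = ≃-trans (toℚᵘ-homo-+ (ℕ→ℚ 2 * mkℚ a dm c) (- ℕ→ℚ 3)) (≃-trans (+-cong twice minusThree) sum)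
    where
    open Data.Integer.Solver.+-*-Solver
    twice : toℚᵘ (ℕ→ℚ 2 * mkℚ a dm c) ≃ mkℚᵘ (+ 2 ℤ.* a) dm
    twice = ≃-trans (toℚᵘ-homo-* (ℕ→ℚ 2) (mkℚ a dm c)) (≃-trans (*-cong (toℚᵘ-ℕ→ℚ 2) (≃-refl {mkℚᵘ a dm}))
              (*≡* (cong (λ k → + 2 ℤ.* a ℤ.* + suc k) (sym (ℕ.+-identityʳ dm)))))
    minusThree : toℚᵘ (- ℕ→ℚ 3) ≃ mkℚᵘ (ℤ.- + 3) 0
    minusThree = ≃-trans (toℚᵘ-homo‿- (ℕ→ℚ 3)) (-‿cong (toℚᵘ-ℕ→ℚ 3))
    sum : mkℚᵘ (+ 2 ℤ.* a) dm ℚᵘ.+ mkℚᵘ (ℤ.- + 3) 0 ≃ mkℚᵘ (numer a (suc dm)) dm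
    sum = *≡* (trans (solve 2 (λ a b → (con (+ 2) :* a :* con (+ 1) :+ (:- con (+ 3)) :* b) :* b
                                    := (con (+ 2) :* a :- con (+ 3) :* b) :* b) refl a (+ suc dm))
                     (cong (λ k → numer a (suc dm) ℤ.* + suc k) (sym (ℕ.*-identityʳ dm))))

  numer-ℕ : ∀ n b → numer (+ n) b ≡ (2 ℕ.* n) ⊖ (3 ℕ.* b)
  numer-ℕ n b = trans (cong₂ ℤ._-_ (sym (pos-* 2 n)) (sym (pos-* 3 b))) (m-n≡m⊖n (2 ℕ.* n) (3 ℕ.* b))

  ⊖-pos : ∀ {m k} → 0ℤ ℤ.< m ⊖ k → k ℕ.< m
  ⊖-pos {m} {k} 0<m⊖k with k ℕ.<? m
  ... | yes k<m = k<m
  ... | no k≮m = ⊥-elim (ℤ.≤⇒≯ (subst (ℤ._≤ 0ℤ) (sym (⊖-≤ (ℕ.≮⇒≥ k≮m))) ℤ.neg-≤-pos) 0<m⊖k)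

  module _ (a : ℤ) (dm : ℕ) .(c : Coprime ℤ.∣ a ∣ (suc dm)) where
    private
      q : ℚ
      q = mkℚ a dm c
      b : ℕ
      b = suc dm
      D : ℤ
      D = numer a b
      d≃ : toℚᵘ ((ℕ→ℚ 2 * q - ℕ→ℚ 3) * (ℕ→ℚ 2 * q - ℕ→ℚ 3)) ≃ mkℚᵘ D dm ℚᵘ.* mkℚᵘ D dm
      d≃ = ≃-trans (toℚᵘ-homo-* (ℕ→ℚ 2 * q - ℕ→ℚ 3) _) (*-cong (toℚᵘ-2q-3 a dm c) (toℚᵘ-2q-3 a dm c))
      cleared : ∀ {i j} → i ℤ.* + 1 ℤ.< j → i ℤ.< j
      cleared {i} {j} = subst (ℤ._< j) (ℤ.*-identityʳ i)

    below-ℤ : BelowAlphaSq q → D ℤ.< 0ℤ ⊎ D ℤ.* D ℤ.< + 5 ℤ.* (+ b ℤ.* + b)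
    below-ℤ (inj₁ neg) with <-respˡ-≃ (toℚᵘ-2q-3 a dm c) (toℚᵘ-mono-< neg)
    ... | *<* lt = inj₁ (cleared lt)
    below-ℤ (inj₂ sq) with <-respʳ-≃ (toℚᵘ-ℕ→ℚ 5) (<-respˡ-≃ d≃ (toℚᵘ-mono-< sq))
    ... | *<* lt = inj₂ (cleared lt)

    above-ℤ : AboveAlphaSq q → 0ℤ ℤ.< D × + 5 ℤ.* (+ b ℤ.* + b) ℤ.< D ℤ.* D
    above-ℤ (pos , sq) with <-respʳ-≃ (toℚᵘ-2q-3 a dm c) (toℚᵘ-mono-< pos)
                         | <-respʳ-≃ d≃ (<-respˡ-≃ (toℚᵘ-ℕ→ℚ 5) (toℚᵘ-mono-< sq))
    ... | *<* lt₁ | *<* lt₂ = subst (ℤ._< D) (ℤ.*-zeroˡ (+ b)) (subst (0ℤ ℤ.* + b ℤ.<_) (ℤ.*-identityʳ D) lt₁)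
                            , subst (+ 5 ℤ.* (+ b ℤ.* + b) ℤ.<_) (ℤ.*-identityʳ (D ℤ.* D)) lt₂

  square-ℤ : ∀ g → + g ℤ.* + g ≡ + (g ℕ.* g)
  square-ℤ g = sym (pos-* g g)

  fiveSquares-ℤ : ∀ b → + 5 ℤ.* (+ b ℤ.* + b) ≡ + (5 ℕ.* (b ℕ.* b))
  fiveSquares-ℤ b = trans (cong (+ 5 ℤ.*_) (square-ℤ b)) (sym (pos-* 5 (b ℕ.* b)))

  below-ℕ : ∀ n dm .(c : Coprime n (suc dm)) → BelowAlphaSq (mkℚ (+ n) dm c)
    → (2 ℕ.* n ∸ 3 ℕ.* suc dm) ℕ.* (2 ℕ.* n ∸ 3 ℕ.* suc dm) ℕ.< 5 ℕ.* (suc dm ℕ.* suc dm)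
  below-ℕ n dm c below with 3 ℕ.* suc dm ℕ.≤? 2 ℕ.* n
  ... | no 2n<3b rewrite ℕ.m≤n⇒m∸n≡0 (ℕ.<⇒≤ (ℕ.≰⇒> 2n<3b)) = ℕ.s≤s ℕ.z≤n
  ... | yes 3b≤2n = decode (below-ℤ (+ n) dm c below)
    where
    g : ℕ
    g = 2 ℕ.* n ∸ 3 ℕ.* suc dm
    D≡g : numer (+ n) (suc dm) ≡ + g
    D≡g = trans (numer-ℕ n (suc dm)) (⊖-≥ 3b≤2n)
    -- with a nonnegative numerator the first alternative is impossible
    decode : numer (+ n) (suc dm) ℤ.< 0ℤ
             ⊎ numer (+ n) (suc dm) ℤ.* numer (+ n) (suc dm) ℤ.< + 5 ℤ.* (+ suc dm ℤ.* + suc dm)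
           → g ℕ.* g ℕ.< 5 ℕ.* (suc dm ℕ.* suc dm)
    decode (inj₁ neg) = ⊥-elim (ℕ.n≮0 (drop‿+<+ (subst (ℤ._< 0ℤ) D≡g neg)))
    decode (inj₂ sq)  = drop‿+<+ (subst₂ ℤ._<_ (square-ℤ g) (fiveSquares-ℤ (suc dm))
                          (subst (λ D → D ℤ.* D ℤ.< + 5 ℤ.* (+ suc dm ℤ.* + suc dm)) D≡g sq))

  above-ℕ : ∀ a dm .(c : Coprime ℤ.∣ a ∣ (suc dm)) → AboveAlphaSq (mkℚ a dm c)
    → ∃[ n ] (a ≡ + n × 5 ℕ.* (suc dm ℕ.* suc dm) ℕ.< (2 ℕ.* n ∸ 3 ℕ.* suc dm) ℕ.* (2 ℕ.* n ∸ 3 ℕ.* suc dm))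
  above-ℕ -[1+ k ] dm c above with above-ℤ -[1+ k ] dm c above
  ... | () , _
  above-ℕ (+ n) dm c above with above-ℤ (+ n) dm c above
  ... | pos , sq = n , refl , drop‿+<+ (subst₂ ℤ._<_ (fiveSquares-ℤ (suc dm)) (square-ℤ (2 ℕ.* n ∸ 3 ℕ.* suc dm))
                     (subst (λ D → + 5 ℤ.* (+ suc dm ℤ.* + suc dm) ℤ.< D ℤ.* D) D≡g sq))
    where
    3b<2n : 3 ℕ.* suc dm ℕ.< 2 ℕ.* n
    3b<2n = ⊖-pos (subst (0ℤ ℤ.<_) (numer-ℕ n (suc dm)) pos)
    D≡g : numer (+ n) (suc dm) ≡ + (2 ℕ.* n ∸ 3 ℕ.* suc dm)
    D≡g = trans (numer-ℕ n (suc dm)) (⊖-≥ (ℕ.<⇒≤ 3b<2n))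

  below-estimate : ∀ q → BelowAlphaSq q → ∀ {X d Z S P}
    → d ℕ.* d ℕ.+ 4 ≡ 5 ℕ.* (X ℕ.* X) → 2 ℕ.* Z ≡ 3 ℕ.* X ℕ.+ d → S ℕ.+ P ≡ Z
    → 1 ℕ.≤ P → 20 ℕ.* (↧ₙ q ℕ.* ↧ₙ q ℕ.* P) ℕ.< X → q * ℕ→ℚ X < ℕ→ℚ S
  below-estimate (mkℚ (+ n) dm c) below {X} {d} {Z} {S} {P} eq half split 1≤P big =
    scaled<ℕ (+ n) dm c {X} {S}
      (ℕ-products< n X S (suc dm) (ratio-above {X} {d} {Z} {S} {P} {n} {suc dm} eq half split (below-ℕ n dm c below) 1≤P big))
  -- a negative q lies below every S/X with X > 0
  below-estimate (mkℚ -[1+ k ] dm c) _ {ℕ.zero} _ _ _ _ ()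
  below-estimate (mkℚ -[1+ k ] dm c) _ {ℕ.suc x} {S = S} _ _ _ _ _ =
    scaled<ℕ -[1+ k ] dm c {suc x} {S} (subst (-[1+ k ] ℤ.* + suc x ℤ.<_) (pos-* S (suc dm)) -<+)

  above-estimate : ∀ r → AboveAlphaSq r → ∀ {X d Z S}
    → d ℕ.* d ℕ.+ 4 ≡ 5 ℕ.* (X ℕ.* X) → 2 ℕ.* Z ≡ 3 ℕ.* X ℕ.+ d → S ℕ.≤ Z → ℕ→ℚ S < r * ℕ→ℚ X
  above-estimate (mkℚ a dm c) above {X} {d} {Z} {S} eq half S≤Z with above-ℕ a dm c above
  ... | n , refl , bound = ℕ<scaled (+ n) dm c {X} {S} (ℕ-products< S (suc dm) n X
    (ℕ.≤-<-trans (ℕ.*-monoˡ-≤ (suc dm) S≤Z) (ratio-below {X} {d} {Z} {n} {suc dm} eq half bound)))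

open import Defs
open import Data.Nat using (ℕ; _≤_)
open import Data.List using (List)
open import Data.List.Membership.Propositional using (_∈_)
open import Data.List.Relation.Unary.Unique.Propositional using (Unique)
open import Data.Rational using (ℚ; _*_; _<_)
open import Data.Product using (_×_; ∃-syntax)
open import Function.Bundles using (_⇔_)
open import Relation.Binary.PropositionalEquality using (_≡_)
open import Data.Nat using (suc; s≤s; _+_; _^_)
import Data.Nat as ℕ
import Data.Nat.Properties as ℕ
open import Data.Rational using (↧ₙ_)
open import Data.Product using (_,_)
open import Relation.Binary.PropositionalEquality using (subst)
open Fibonacci using (oddFib; lucas; pell; doubling; oddFib-dominates)
open Elenas using (enumNonLeaf; rootChildSum; rootChildSum-nonLeaf; count-elenas; total-elenas)
open RationalEstimates using (below-estimate; above-estimate)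

mainTheorem2 : (elenas : ℕ → List PTree)
    → (∀ n → Unique (elenas n))
    → (∀ n t → (t ∈ elenas n) ⇔ (IsElena t × size t ≡ n))
    → ∀ (q r : ℚ) → BelowAlphaSq q → AboveAlphaSq r
    → ∃[ N ] (∀ n → N ≤ n →
         (q * count (elenas n) < totalRootChildren (elenas n))
         × (totalRootChildren (elenas n) < r * count (elenas n)))
mainTheorem2 elenas unique spec q r q<α² α²<r = 3 + 4 ℕ.* c , bounds
  where
  -- the lower estimate needs 20·den(q)²·2^m < F(2m+1), true once m > 4·20·den(q)²
  c : ℕ
  c = 20 ℕ.* (↧ₙ q ℕ.* ↧ₙ q)
  bounds : ∀ n → 3 + 4 ℕ.* c ≤ n
    → (q * count (elenas n) < totalRootChildren (elenas n))
      × (totalRootChildren (elenas n) < r * count (elenas n))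
  bounds (suc (suc m)) (s≤s (s≤s 4c<m))
    rewrite count-elenas elenas unique spec m | total-elenas elenas unique spec m =
      below-estimate q q<α² {X} {d} {Z} {S} {2 ^ m} (pell m) (doubling m) deficit (ℕ.m^n>0 2 m) large
    , above-estimate r α²<r {X} {d} {Z} {S} (pell m) (doubling m) (subst (S ℕ.≤_) deficit (ℕ.m≤m+n S (2 ^ m)))
    where
    -- the Pell pair (F(2m+1), L(2m+1)), the next odd Fibonacci number and the total degree
    X d Z S : ℕ
    X = oddFib (suc m)
    d = lucas m
    Z = oddFib (suc (suc m))
    S = rootChildSum (enumNonLeaf (suc (suc m)))
    deficit : S + 2 ^ m ≡ Z
    deficit = rootChildSum-nonLeaf m
    large : 20 ℕ.* (↧ₙ q ℕ.* ↧ₙ q ℕ.* 2 ^ m) ℕ.< X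
    large = subst (ℕ._< X) (ℕ.*-assoc 20 (↧ₙ q ℕ.* ↧ₙ q) (2 ^ m)) (oddFib-dominates c m 4c<m)
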